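{- For any (finite) tree $T$ and any integer $k\ge 1$, $\mathrm{capt}_k(T)=\mathrm{rad}_k(T)$.
   Context: Graphs are reflexive. The game of Cops and Robbers: cops choose starting vertices (round 0), then the robber; players alternate, cops (any subset) moving to adjacent vertices or staying put, then the robber moving or staying; cops win by occupying the robber's vertex. For $k$ at least the cop number, $\mathrm{capt}_k(G)$ is the minimum over $k$-cop strategies of the number of rounds (excluding round 0) until capture against an optimally evading robber. $\mathrm{rad}_k(G)=\min_{S\subseteq V(G),\,|S|\le k}\max_{v\in V(G)}\mathrm{dist}(v,S)$. -}

module Defs where

open import Data.Nat using (ℕ; zero; suc; _≤_)
open import Data.Fin using (Fin)
open import Data.Fin.Subset using (Subset; _∈_; ∣_∣)
open import Data.List using (List; []; _∷_; length; _++_; [_])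
open import Data.List.Relation.Unary.Unique.Propositional using (Unique)
open import Data.Product using (Σ; ∃; _×_; _,_)
open import Data.Sum using (_⊎_)
open import Relation.Nullary using (¬_; Dec)
open import Relation.Binary.PropositionalEquality using (_≡_)

-- A finite simple graph on vertex set Fin n.  E is the (irreflexive,
-- symmetric) edge relation; every vertex additionally carries a loop,
-- modelled by the reflexive closure `Move` below.
record Graph : Set₁ where
  field
    n       : ℕ
    E       : Fin n → Fin n → Set
    E-sym   : ∀ {u v} → E u v → E v u
    E-irr   : ∀ v → ¬ E v v
    E-dec   : ∀ u v → Dec (E u v)

module _ (G : Graph) where
  open Graph G

  V : Set
  V = Fin n

  Move : V → V → Set
  Move u v = u ≡ v ⊎ E u v

  -- Reach r u v : there is a walk of length r from u to v in the
  -- reflexive graph, i.e. dist(u,v) ≤ r.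
  data Reach : ℕ → V → V → Set where
    here  : ∀ {u} → Reach zero u u
    there : ∀ {r u w v} → Move u w → Reach r w v → Reach (suc r) u v

  -- connected graphs are nonempty (standard convention)
  Connected : Set
  Connected = 1 ≤ n × (∀ u v → ∃ λ r → Reach r u v)

  data Chain : List V → Set where
    nil  : Chain []
    one  : ∀ {x} → Chain (x ∷ [])
    cons : ∀ {x y xs} → E x y → Chain (y ∷ xs) → Chain (x ∷ y ∷ xs)

  Cycle : Set
  Cycle = Σ V λ x → Σ (List V) λ ys → Σ V λ y →
            Chain (x ∷ ys ++ [ y ]) × Unique (x ∷ ys ++ [ y ]) ×
            1 ≤ length ys × E y x

  IsTree : Set
  IsTree = Connected × ¬ Cycle

  Dominates : Subset n → ℕ → Set
  Dominates S r = ∀ v → ∃ λ s → s ∈ S × Reach r v s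

  IsRadius : ℕ → ℕ → Set
  IsRadius k r =
    (Σ (Subset n) λ S → ∣ S ∣ ≤ k × Dominates S r) ×
    (∀ r' (S : Subset n) → ∣ S ∣ ≤ k → Dominates S r' → r ≤ r')

  Cops : ℕ → Set
  Cops k = Fin k → V

  Caught : ∀ {k} → Cops k → V → Set
  Caught C x = ∃ λ i → C i ≡ x

  CopsMove : ∀ {k} → Cops k → Cops k → Set
  CopsMove C C' = ∀ i → Move (C i) (C' i)

  -- CopsWin t C x : cops on C, robber on x, cops to move; the cops can
  -- force capture within at most t further rounds.
  data CopsWin {k : ℕ} : ℕ → Cops k → V → Set where
    caught : ∀ {t C x} → Caught C x → CopsWin t C x
    step   : ∀ {t C x} (C' : Cops k) → CopsMove C C' →
             (Caught C' x ⊎ (∀ x' → Move x x' → CopsWin t C' x')) →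
             CopsWin (suc t) C x

  -- k cops have a strategy capturing any robber within t rounds
  -- (round 0, the placement, is not counted)
  CanCaptureIn : ℕ → ℕ → Set
  CanCaptureIn k t = Σ (Cops k) λ C₀ → ∀ x₀ → CopsWin t C₀ x₀

  IsCaptureTime : ℕ → ℕ → Set
  IsCaptureTime k t =
    CanCaptureIn k t × (∀ t' → CanCaptureIn k t' → t ≤ t')

-- Any strategy capturing within t rounds already dominates the tree from
-- the cops' starting vertices with radius t: against a robber who never
-- moves, some cop must walk to him in t steps.  Conversely, place the cops
-- on a k-set S of radius r and let every cop step along the unique path
-- towards the robber.  In a tree the robber's territory (the vertices he
-- can reach without meeting a cop) then only shrinks, and every cop
-- adjacent to the territory steps into it, so the distance from each
-- territory vertex to its nearest cop drops by one per round.
module Submission where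

open import Defs
open import Data.Nat using (ℕ; zero; suc; _≤_; _<_; _+_; _∸_; z≤n; s≤s; _≤?_)
open import Data.Nat.Properties
  using (≤-reflexive; ≤-trans; +-suc; +-monoʳ-≤; n≤1+n; m≤m+n; m≤n+m; n<1+n;
         m∸n+n≡m; m<1+n⇒m<n∨m≡n; ≮⇒≥; module ≤-Reasoning)
open import Data.Fin using (Fin; fromℕ<; _≟_) renaming (zero to fzero; suc to fsuc)
open import Data.Fin.Properties using (any?; all?)
open import Data.Fin.Subset using (Subset; _∈_; ∣_∣; ⁅_⁆; _∪_) renaming (⊥ to ∅)
open import Data.Fin.Subset.Properties
  using (_∈?_; anySubset?; x∈⁅x⁆; ∣⁅x⁆∣≡1; ∣⊥∣≡0; p⊆p∪q; q⊆p∪q)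
open import Data.Bool using (true; false)
open import Data.Vec using ([]; _∷_; here; there)
import Data.Vec.Functional as Vector
open import Data.List using (List; []; _∷_; length; _++_; [_])
import Data.List.Membership.Propositional as List
import Data.List.Membership.DecPropositional as DecList
import Data.List.Relation.Unary.Any as Any
open import Data.List.Relation.Unary.All as All using (All; []; _∷_)
open import Data.List.Relation.Unary.All.Properties.Core using (¬Any⇒All¬)
open import Data.List.Relation.Unary.AllPairs using ([]; _∷_)
open import Data.List.Relation.Unary.Unique.Propositional using (Unique)
open import Data.Product using (Σ; ∃; _×_; _,_; proj₁; proj₂)
open import Data.Sum using (_⊎_; inj₁; inj₂; [_,_]′)
open import Data.Empty using (⊥-elim)
open import Function using (_∘_)
open import Relation.Nullary using (¬_; Dec; yes; no)
open import Relation.Nullary.Decidable using (_×-dec_; _⊎-dec_)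
open import Relation.Unary using (Decidable)
open import Relation.Binary.PropositionalEquality
  using (_≡_; _≢_; refl; sym; cong; subst)

∣p∪q∣≤∣p∣+∣q∣ : ∀ {m} (p q : Subset m) → ∣ p ∪ q ∣ ≤ ∣ p ∣ + ∣ q ∣
∣p∪q∣≤∣p∣+∣q∣ []          []          = z≤n
∣p∪q∣≤∣p∣+∣q∣ (true ∷ p)  (false ∷ q) = s≤s (∣p∪q∣≤∣p∣+∣q∣ p q)
∣p∪q∣≤∣p∣+∣q∣ (true ∷ p)  (true ∷ q)  =
  s≤s (≤-trans (∣p∪q∣≤∣p∣+∣q∣ p q) (+-monoʳ-≤ ∣ p ∣ (n≤1+n ∣ q ∣)))
∣p∪q∣≤∣p∣+∣q∣ (false ∷ p) (true ∷ q)  =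
  subst (suc ∣ p ∪ q ∣ ≤_) (sym (+-suc ∣ p ∣ ∣ q ∣)) (s≤s (∣p∪q∣≤∣p∣+∣q∣ p q))
∣p∪q∣≤∣p∣+∣q∣ (false ∷ p) (false ∷ q) = ∣p∪q∣≤∣p∣+∣q∣ p q

image : ∀ {m k} → (Fin k → Fin m) → Subset m
image {k = zero}  f = ∅
image {k = suc k} f = ⁅ f fzero ⁆ ∪ image (f ∘ fsuc)

∣image∣≤ : ∀ {m k} (f : Fin k → Fin m) → ∣ image f ∣ ≤ k
∣image∣≤ {m} {zero}  f = ≤-reflexive (∣⊥∣≡0 m)
∣image∣≤ {m} {suc k} f = begin
  ∣ ⁅ f fzero ⁆ ∪ image (f ∘ fsuc) ∣     ≤⟨ ∣p∪q∣≤∣p∣+∣q∣ ⁅ f fzero ⁆ (image (f ∘ fsuc)) ⟩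
  ∣ ⁅ f fzero ⁆ ∣ + ∣ image (f ∘ fsuc) ∣ ≡⟨ cong (_+ ∣ image (f ∘ fsuc) ∣) (∣⁅x⁆∣≡1 (f fzero)) ⟩
  suc ∣ image (f ∘ fsuc) ∣               ≤⟨ s≤s (∣image∣≤ (f ∘ fsuc)) ⟩
  suc k                                  ∎
  where open ≤-Reasoning

∈-image : ∀ {m k} (f : Fin k → Fin m) i → f i ∈ image f
∈-image {k = suc k} f fzero    = p⊆p∪q (image (f ∘ fsuc)) (x∈⁅x⁆ (f fzero))
∈-image {k = suc k} f (fsuc i) = q⊆p∪q ⁅ f fzero ⁆ (image (f ∘ fsuc)) (∈-image (f ∘ fsuc) i)

-- The default value fills the positions left over when ∣ S ∣ < k.
cover : ∀ {A : Set} {m k} (S : Subset m) (f : Fin m → A) → ∣ S ∣ ≤ k → A →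
        Σ (Fin k → A) λ g → ∀ {s} → s ∈ S → ∃ λ i → g i ≡ f s
cover []          f _           d = (λ _ → d) , λ ()
cover (false ∷ S) f ∣S∣≤k       d with cover S (f ∘ fsuc) ∣S∣≤k d
... | g , covers = g , λ { (there s∈S) → covers s∈S }
cover (true ∷ S)  f (s≤s ∣S∣≤k) d with cover S (f ∘ fsuc) ∣S∣≤k d
... | g , covers = f fzero Vector.∷ g ,
                   λ { here        → fzero , refl
                     ; (there s∈S) → let i , gi≡fs = covers s∈S in fsuc i , gi≡fs }

upper-bound : ∀ {m} (f : Fin m → ℕ) → ∃ λ B → ∀ i → f i ≤ B
upper-bound {zero}  f = 0 , λ ()
upper-bound {suc m} f with upper-bound (f ∘ fsuc)
... | B , bound = f fzero + B ,
                  λ { fzero    → m≤m+n (f fzero) B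
                    ; (fsuc i) → ≤-trans (bound i) (m≤n+m B (f fzero)) }

module _ {P : ℕ → Set} (P? : Decidable P) where

  private
    least-below : ∀ b → (∃ λ r → P r × (∀ r′ → r′ < r → ¬ P r′)) ⊎ (∀ r′ → r′ < b → ¬ P r′)
    least-below zero = inj₂ (λ _ ())
    least-below (suc b) with least-below b
    ... | inj₁ least = inj₁ least
    ... | inj₂ none with P? b
    ...   | yes Pb = inj₁ (b , Pb , none)
    ...   | no ¬Pb = inj₂ λ r′ r′<1+b →
      [ none r′ , (λ { refl → ¬Pb }) ]′ (m<1+n⇒m<n∨m≡n r′<1+b)

  least : ∀ {b} → P b → ∃ λ r → P r × (∀ r′ → P r′ → r ≤ r′)
  least {b} Pb with least-below (suc b)
  ... | inj₁ (r , Pr , below) = r , Pr , λ r′ Pr′ → ≮⇒≥ (λ r′<r → below r′ r′<r Pr′)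
  ... | inj₂ none = ⊥-elim (none b (n<1+n b) Pb)

module Distance (G : Graph) where
  open Graph G

  Move-sym : ∀ {u v} → Move G u v → Move G v u
  Move-sym (inj₁ eq) = inj₁ (sym eq)
  Move-sym (inj₂ e)  = inj₂ (E-sym e)

  Move? : ∀ u v → Dec (Move G u v)
  Move? u v = (u ≟ v) ⊎-dec E-dec u v

  Reach-refl : ∀ r {u} → Reach G r u u
  Reach-refl zero    = here
  Reach-refl (suc r) = there (inj₁ refl) (Reach-refl r)

  Reach-snoc : ∀ {r u v w} → Reach G r u v → Move G v w → Reach G (suc r) u w
  Reach-snoc here         m = there m here
  Reach-snoc (there m′ p) m = there m′ (Reach-snoc p m)

  Reach-mono : ∀ {r r′ u v} → r ≤ r′ → Reach G r u v → Reach G r′ u v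
  Reach-mono {r} {r′} r≤r′ p = subst (λ s → Reach G s _ _) (m∸n+n≡m r≤r′) (wait (r′ ∸ r) p)
    where
      wait : ∀ s {r u v} → Reach G r u v → Reach G (s + r) u v
      wait zero    p = p
      wait (suc s) p = there (inj₁ refl) (wait s p)

  Reach? : ∀ r u v → Dec (Reach G r u v)
  Reach? zero u v with u ≟ v
  ... | yes refl = yes here
  ... | no u≢v   = no λ { here → u≢v refl }
  Reach? (suc r) u v with any? (λ w → Move? u w ×-dec Reach? r w v)
  ... | yes (w , m , p) = yes (there m p)
  ... | no ∄w           = no λ { (there m p) → ∄w (_ , m , p) }

  Dominates? : ∀ S r → Dec (Dominates G S r)
  Dominates? S r = all? (λ v → any? (λ s → (s ∈? S) ×-dec Reach? r v s))

  Dominable : ℕ → ℕ → Set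
  Dominable k r = Σ (Subset n) λ S → ∣ S ∣ ≤ k × Dominates G S r

  radius-exists : Connected G → ∀ {k} → 1 ≤ k → ∃ λ r → IsRadius G k r
  radius-exists (1≤n , connected) {k} 1≤k with least Dominable? by-centre
    where
      Dominable? : ∀ r → Dec (Dominable k r)
      Dominable? r = anySubset? (λ S → (∣ S ∣ ≤? k) ×-dec Dominates? S r)

      centre : V G
      centre = fromℕ< 1≤n

      eccentricity : ∃ λ B → ∀ v → proj₁ (connected v centre) ≤ B
      eccentricity = upper-bound (λ v → proj₁ (connected v centre))

      by-centre : Dominable k (proj₁ eccentricity)
      by-centre = ⁅ centre ⁆ , subst (_≤ k) (sym (∣⁅x⁆∣≡1 centre)) 1≤k ,
                  λ v → centre , x∈⁅x⁆ centre ,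
                        Reach-mono (proj₂ eccentricity v) (proj₂ (connected v centre))
  ... | r , dominable , minimal = r , dominable , λ r′ S ∣S∣≤k dom → minimal r′ (S , ∣S∣≤k , dom)

  CopsWin⇒Reach : ∀ {k t} {C : Cops G k} {x} → CopsWin G t C x → ∃ λ i → Reach G t x (C i)
  CopsWin⇒Reach {t = t} (caught (i , Ci≡x)) = i , subst (Reach G t _) (sym Ci≡x) (Reach-refl t)
  CopsWin⇒Reach (step C′ moves (inj₁ (i , C′i≡x))) =
    i , there (subst (λ y → Move G y _) C′i≡x (Move-sym (moves i))) (Reach-refl _)
  CopsWin⇒Reach {x = x} (step C′ moves (inj₂ win)) with CopsWin⇒Reach (win x (inj₁ refl))
  ... | i , p = i , Reach-snoc p (Move-sym (moves i))

  radius≤captureTime : ∀ {k r t} → IsRadius G k r → CanCaptureIn G k t → r ≤ t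
  radius≤captureTime (_ , minimal) (C₀ , win) = minimal _ (image C₀) (∣image∣≤ C₀) near-cop
    where
      near-cop : Dominates G (image C₀) _
      near-cop v with CopsWin⇒Reach (win v)
      ... | i , p = C₀ i , ∈-image C₀ i , p

module Walks (G : Graph) where
  open Graph G
  open Distance G using (Move-sym)

  data WalkIn (P : V G → Set) : V G → V G → Set where
    stop : ∀ {a} → P a → WalkIn P a a
    move : ∀ {a w b} → P a → Move G a w → WalkIn P w b → WalkIn P a b

  module _ {P : V G → Set} where

    WalkIn-head : ∀ {a b} → WalkIn P a b → P a
    WalkIn-head (stop Pa)     = Pa
    WalkIn-head (move Pa _ _) = Pa

    WalkIn-last : ∀ {a b} → WalkIn P a b → P b
    WalkIn-last (stop Pb)     = Pb
    WalkIn-last (move _ _ ps) = WalkIn-last ps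

    WalkIn-snoc : ∀ {a b c} → WalkIn P a b → Move G b c → P c → WalkIn P a c
    WalkIn-snoc (stop Pa)       m Pc = move Pa m (stop Pc)
    WalkIn-snoc (move Pa m′ ps) m Pc = move Pa m′ (WalkIn-snoc ps m Pc)

    WalkIn-reverse : ∀ {a b} → WalkIn P a b → WalkIn P b a
    WalkIn-reverse (stop Pa)      = stop Pa
    WalkIn-reverse (move Pa m ps) = WalkIn-snoc (WalkIn-reverse ps) (Move-sym m) Pa

    WalkIn-++ : ∀ {a b c} → WalkIn P a b → WalkIn P b c → WalkIn P a c
    WalkIn-++ (stop _)       qs = qs
    WalkIn-++ (move Pa m ps) qs = move Pa m (WalkIn-++ ps qs)

  WalkIn-map : ∀ {P Q : V G → Set} {a b} → (∀ {x} → P x → Q x) → WalkIn P a b → WalkIn Q a b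
  WalkIn-map f (stop Pa)      = stop (f Pa)
  WalkIn-map f (move Pa m ps) = move (f Pa) m (WalkIn-map f ps)

  data Path : V G → V G → List (V G) → Set where
    done : ∀ {a} → Path a a [ a ]
    edge : ∀ {a w b L} → E a w → Path w b L → Path a b (a ∷ L)

  edge-Chain : ∀ {c a b L} → E c a → Path a b L → Chain G (c ∷ L)
  edge-Chain e done        = cons e one
  edge-Chain e (edge e′ p) = cons e (edge-Chain e′ p)

  Path-init : ∀ {a b L} → Path a b L → ∃ λ ys → L ≡ ys ++ [ b ]
  Path-init done                 = [] , refl
  Path-init (edge {a = a} _ p) with Path-init p
  ... | ys , L≡ys++b = a ∷ ys , cong (a ∷_) L≡ys++b

  Path-split : ∀ {a b L} → a ≢ b → Path a b L → ∃ λ ys → L ≡ ys ++ [ b ] × 1 ≤ length ys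
  Path-split a≢b done = ⊥-elim (a≢b refl)
  Path-split {a} _ (edge _ p) with Path-init p
  ... | ys , L≡ys++b = a ∷ ys , cong (a ∷_) L≡ys++b , s≤s z≤n

  SimplePathIn : (V G → Set) → V G → V G → Set
  SimplePathIn P a b = Σ (List (V G)) λ L → Path a b L × Unique L × All P L

  module _ {P : V G → Set} where

    suffix : ∀ {a w b L} → Path w b L → Unique L → All P L → a List.∈ L → SimplePathIn P a b
    suffix done         u       Ps       (Any.here refl) = _ , done , u , Ps
    suffix (edge e p)   u       Ps       (Any.here refl) = _ , edge e p , u , Ps
    suffix (edge _ p)   (_ ∷ u) (_ ∷ Ps) (Any.there a∈L) = suffix p u Ps a∈L

    WalkIn⇒SimplePathIn : ∀ {a b} → WalkIn P a b → SimplePathIn P a b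
    WalkIn⇒SimplePathIn (stop Pa)               = _ , done , [] ∷ [] , Pa ∷ []
    WalkIn⇒SimplePathIn (move _ (inj₁ refl) ps) = WalkIn⇒SimplePathIn ps
    WalkIn⇒SimplePathIn {a} (move Pa (inj₂ e) ps) with WalkIn⇒SimplePathIn ps
    ... | L , p , u , Ps with DecList._∈?_ _≟_ a L
    ...   | yes a∈L = suffix p u Ps a∈L
    ...   | no  a∉L = a ∷ L , edge e p , ¬Any⇒All¬ L a∉L ∷ u , Pa ∷ Ps

  -- A walk from u to w avoiding their common neighbour c closes a cycle through c.
  neighbours-separated : ¬ Cycle G → ∀ {c u w} → E c u → E c w → u ≢ w → ¬ WalkIn (_≢ c) u w
  neighbours-separated acyclic {c} {w = w} e-cu e-cw u≢w ps with WalkIn⇒SimplePathIn ps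
  ... | L , p , unique , avoid-c with Path-split u≢w p
  ...   | ys , refl , 1≤∣ys∣ =
    acyclic (c , ys , w , edge-Chain e-cu p ,
             All.map (λ y≢c c≡y → y≢c (sym c≡y)) avoid-c ∷ unique , 1≤∣ys∣ , E-sym e-cw)

  exit-unique : ¬ Cycle G → ∀ {p u w x} → E p u → E p w →
                WalkIn (_≢ p) u x → WalkIn (_≢ p) w x → u ≡ w
  exit-unique acyclic {u = u} {w} e-pu e-pw ps qs with u ≟ w
  ... | yes u≡w = u≡w
  ... | no  u≢w = ⊥-elim (neighbours-separated acyclic e-pu e-pw u≢w
                            (WalkIn-++ ps (WalkIn-reverse qs)))

  -- Scanning a walk from y to x: it avoids p, or its last visit to p is
  -- followed by an edge into a walk avoiding p.
  last-exit : ∀ {p x r y} → p ≢ x → Reach G r y x →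
              (∃ λ w → E p w × WalkIn (_≢ p) w x) ⊎ WalkIn (_≢ p) y x
  last-exit p≢x here = inj₂ (stop (λ x≡p → p≢x (sym x≡p)))
  last-exit {p} {y = y} p≢x (there {w = z} m rest) with last-exit p≢x rest
  ... | inj₁ exit = inj₁ exit
  ... | inj₂ ps with y ≟ p
  ...   | no  y≢p  = inj₂ (move y≢p m ps)
  ...   | yes refl with m
  ...     | inj₁ refl = ⊥-elim (WalkIn-head ps refl)
  ...     | inj₂ e    = inj₁ (z , e , ps)

  exit : Connected G → ∀ {p x} → p ≢ x → ∃ λ w → E p w × WalkIn (_≢ p) w x
  exit (_ , connected) {p} {x} p≢x with last-exit p≢x (proj₂ (connected p x))
  ... | inj₁ exit′ = exit′
  ... | inj₂ ps    = ⊥-elim (WalkIn-head ps refl)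

module Capture (T : Graph) (tree : IsTree T) (k : ℕ) where
  open Graph T
  open Distance T using (Reach-refl)
  open Walks T

  towards : V T → V T → V T
  towards p x with p ≟ x
  ... | yes _   = p
  ... | no p≢x = proj₁ (exit (proj₁ tree) p≢x)

  towards-Move : ∀ p x → Move T p (towards p x)
  towards-Move p x with p ≟ x
  ... | yes _   = inj₁ refl
  ... | no p≢x = inj₂ (proj₁ (proj₂ (exit (proj₁ tree) p≢x)))

  towards-unique : ∀ {p x u} → p ≢ x → E p u → WalkIn (_≢ p) u x → towards p x ≡ u
  towards-unique {p} {x} p≢x e-pu ps with p ≟ x
  ... | yes p≡x  = ⊥-elim (p≢x p≡x)
  ... | no  p≢x′ with exit (proj₁ tree) p≢x′
  ...   | w , e-pw , qs = exit-unique (proj₂ tree) e-pw e-pu qs ps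

  Free : Cops T k → V T → Set
  Free C y = ¬ Caught T C y

  caught? : ∀ (C : Cops T k) y → Dec (Caught T C y)
  caught? C y = any? (λ i → C i ≟ y)

  Territory : Cops T k → V T → V T → Set
  Territory C x = WalkIn (Free C) x

  Guarded : ℕ → Cops T k → V T → Set
  Guarded d C x = ∀ v → Territory C x v → ∃ λ i → Reach T d v (C i)

  chase : Cops T k → V T → Cops T k
  chase C x i = towards (C i) x

  -- The territory, reversed, walks from u to the robber avoiding C i, so u is
  -- the unique exit from C i towards x.
  chase-enters : ∀ {C x u} i → Territory C x u → Move T u (C i) → chase C x i ≡ u
  chase-enters i territory (inj₁ u≡Ci) = ⊥-elim (WalkIn-last territory (i , sym u≡Ci))
  chase-enters {C} {x} i territory (inj₂ e-uCi) =
    towards-unique Ci≢x (E-sym e-uCi)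
      (WalkIn-map (λ free y≡Ci → free (i , sym y≡Ci)) (WalkIn-reverse territory))
    where
      Ci≢x : C i ≢ x
      Ci≢x Ci≡x = WalkIn-head territory (i , Ci≡x)

  territory-shrinks : ∀ {C x y v} → Territory C x y →
                      WalkIn (Free (chase C x)) y v → Territory C x v
  territory-shrinks territory (stop _) = territory
  territory-shrinks {C} territory (move {w = z} free m rest) with caught? C z
  ... | yes (i , refl) = ⊥-elim (free (i , chase-enters i territory m))
  ... | no  z-free     = territory-shrinks (WalkIn-snoc territory m z-free) rest

  -- The first occupied vertex on a walk out of the territory is vacated by its
  -- cop towards the vertex just before it.
  chase-approaches : ∀ {C x y z} d → Territory C x y → Reach T (suc d) y z → Caught T C z →
                     ∃ λ j → Reach T d y (chase C x j)
  chase-approaches {C} {y = y} d territory (there {w = w} m rest) z-caught with caught? C w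
  ... | yes (j , refl) = j , subst (Reach T d y) (sym (chase-enters j territory m)) (Reach-refl d)
  ... | no  w-free with d | rest
  ...   | zero  | here  = ⊥-elim (w-free z-caught)
  ...   | suc d | rest′ with chase-approaches d (WalkIn-snoc territory m w-free) rest′ z-caught
  ...     | j , p = j , there m p

  chase-guards : ∀ {d C x x′} → Free C x → Free (chase C x) x → Move T x x′ →
                 Guarded (suc d) C x → Guarded d (chase C x) x′
  chase-guards {d} x-free x-free′ m guarded v territory′ =
    let territory = territory-shrinks (stop x-free) (move x-free′ m territory′)
        i , p     = guarded v territory
    in chase-approaches d territory p (i , refl)

  Guarded⇒CopsWin : ∀ d C x → Guarded d C x → CopsWin T d C x
  Guarded⇒CopsWin d C x guarded with caught? C x
  ... | yes x-caught = caught x-caught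
  Guarded⇒CopsWin zero C x guarded | no x-free with guarded x (stop x-free)
  ... | i , here = caught (i , refl)
  Guarded⇒CopsWin (suc d) C x guarded | no x-free with caught? (chase C x) x
  ... | yes x-caught′ = step (chase C x) (λ i → towards-Move (C i) x) (inj₁ x-caught′)
  ... | no  x-free′   = step (chase C x) (λ i → towards-Move (C i) x) (inj₂ λ x′ m →
    Guarded⇒CopsWin d (chase C x) x′ (chase-guards x-free x-free′ m guarded))

  capture-within : ∀ {S r} → ∣ S ∣ ≤ k → Dominates T S r → CanCaptureIn T k r
  capture-within {S} {r} ∣S∣≤k dominates = C₀ , λ x → Guarded⇒CopsWin r C₀ x (guarded x)
    where
      placement : Σ (Cops T k) λ C → ∀ {s} → s ∈ S → ∃ λ i → C i ≡ s
      placement = cover S (λ s → s) ∣S∣≤k (fromℕ< (proj₁ (proj₁ tree)))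
      C₀ : Cops T k
      C₀ = proj₁ placement

      guarded : ∀ x → Guarded r C₀ x
      guarded x v _ with dominates v
      ... | s , s∈S , p with proj₂ placement s∈S
      ...   | i , C₀i≡s = i , subst (Reach T r v) (sym C₀i≡s) p

corollary2p6 : (T : Graph) → IsTree T → (k : ℕ) → 1 ≤ k →
    Σ ℕ (λ r → IsRadius T k r × IsCaptureTime T k r)
corollary2p6 T tree k 1≤k with Distance.radius-exists T (proj₁ tree) 1≤k
... | r , radius@((S , ∣S∣≤k , dominates) , _) =
  r , radius ,
  Capture.capture-within T tree k ∣S∣≤k dominates ,
  λ _ capture → Distance.radius≤captureTime T radius capture
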